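{- Let $\mathit{Act}$ be a set of action labels (possibly containing $\tau$) and let $\mathit{int}\notin\mathit{Act}$ be an additional internal action label. For each $a\in\mathit{Act}\cup\{\mathit{int}\}$ let $E_a$ be a set. Consider a clustered linear process equation (the implementation) with set of states $D$ and initial state $d_0\in D$, $$X(d{:}D)=\sum_{a\in\mathit{Act}\cup\{\mathit{int}\}}\ \sum_{e_a\in E_a} c_a(d,e_a)\to a(f_a(d,e_a))\cdot X(g_a(d,e_a)),$$ and a predicate $\mathcal I$ on $D$ that is an invariant of $X$ (i.e. $\mathcal I(d)\wedge c_a(d,e_a)\Rightarrow \mathcal I(g_a(d,e_a))$ for all $a,d,e_a$) with $\mathcal I(d_0)$. Consider also a clustered linear process equation (the specification) with set of states $D'$ and initial state $d_0'\in D'$, $$Y(d'{:}D')=\sum_{a\in\mathit{Act}\cup\{\mathit{int}\}}\ \sum_{e_a\in E_a} c'_a(d',e_a)\to a(f'_a(d',e_a))\cdot Y(g'_a(d',e_a)).$$ Suppose there are a map $h:D\to D'$ (state mapping), a predicate $\mathit{FC}:D\to\mathbb B$ (focus condition), a well-founded ordering $<_M$ on $D$, and a map $p:D'\to\{\Delta,\nabla\}$ (cone labeling) such that $h(d_0)=d_0'$ and for every $d\in D$ with $\mathcal I(d)$ the following ten requirements hold: (I) if $\neg\mathit{FC}(d)$, then there is $e\in E_{\mathit{int}}$ with $c_{\mathit{int}}(d,e)$ and $g_{\mathit{int}}(d,e)<_M d$; (II) for all $e\in E_{\mathit{int}}$, $c_{\mathit{int}}(d,e)\Rightarrow h(d)=h(g_{\mathit{int}}(d,e))$;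 (III) for all $a\in\mathit{Act}$ and $e\in E_a$, if $\mathit{FC}(d)$ and $c'_a(h(d),e)$, then there is $d_{\mathit{int}}\in D$ with $d\xrightarrow{\mathit{int}}{}^{*} d_{\mathit{int}}$ and $c_a(d_{\mathit{int}},e)$; (IV) for all $a\in\mathit{Act}$ and $e\in E_a$, $c_a(d,e)\Rightarrow c'_a(h(d),e)$; (V) for all $a\in\mathit{Act}$ and $e\in E_a$, $c_a(d,e)\Rightarrow f_a(d,e)=f'_a(h(d),e)$; (VI) for all $a\in\mathit{Act}$ and $e\in E_a$, $c_a(d,e)\Rightarrow h(g_a(d,e))=g'_a(h(d),e)$; (I$_\Delta$) for all $e\in E_{\mathit{int}}$, $c'_{\mathit{int}}(h(d),e)\Rightarrow g'_{\mathit{int}}(h(d),e)=h(d)$; (II$_\Delta$) $p(h(d))=\Delta$ if and only if there is $e\in E_{\mathit{int}}$ with $c'_{\mathit{int}}(h(d),e)$; (III$_\Delta$) if $\mathit{FC}(d)$, then $p(h(d))=\Delta$ if and only if there is $e\in E_{\mathit{int}}$ with $c_{\mathit{int}}(d,e)$; (IV$_\Delta$) for all $e\in E_{\mathit{int}}$, if $p(h(d))=\nabla$ and $c_{\mathit{int}}(d,e)$, then $g_{\mathit{int}}(d,e)<_M d$. Then $X$ (with initial state $d_0$) and $Y$ (with initial state $d_0'$) are divergence-preserving branching bisimilar.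
   Context: A clustered linear process equation (LPE) has the form $Z(d{:}D)=\sum_{a}\sum_{e_a\in E_a} c_a(d,e_a)\to a(f_a(d,e_a))\cdot Z(g_a(d,e_a))$, where $D$ is a set of states, $a$ ranges over action labels, $c_a(d,e_a)$ is a boolean condition saying when action $a$ with parameter $f_a(d,e_a)$ is enabled in state $d$, and $g_a(d,e_a)$ is the resulting state. It determines transitions: $d\xrightarrow{l}d'$ iff there are $a$ and $e_a\in E_a$ with $l=a(f_a(d,e_a))$, $c_a(d,e_a)$ and $g_a(d,e_a)=d'$. For a label $l$, $d\xrightarrow{l}{}^{*}d'$ means there are finitely many states $d=d_0,\dots,d_k=d'$ ($k\ge 0$) with $d_i\xrightarrow{l}d_{i+1}$ for all $i<k$. The action $\mathit{int}$ is an internal (silent) action: transitions labeled $\mathit{int}$ are regarded as $\tau$-transitions, i.e. in the definition below "$\xrightarrow{\tau}$" refers to silent steps (labeled $\tau$ or $\mathit{int}$). A relation $R\subseteq D\times D'$ between the states of two LPEs is a divergence-preserving branching bisimulation iff for all $s\in D$, $t\in D'$ and labels $l$: (B1) if $sRt$ and $s\xrightarrow{l}s'$, then either $l=\tau$ and $s'Rt$, or there are $t',t''$ with $t\xrightarrow{\tau}{}^{*}t'\xrightarrow{l}t''$, $sRt'$ and $s'Rt''$; (B2) if $sRt$ and $t\xrightarrow{l}t'$, then either $l=\tau$ and $sRt'$, or there are $s',s''$ with $s\xrightarrow{\tau}{}^{*}s'\xrightarrow{l}s''$, $s'Rt$ and $s''Rt'$; (D1) if $sRt$ and there is an infinite sequence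 $(s_n)_{n\in\mathbb N}$ with $s_0=s$, $s_k\xrightarrow{\tau}s_{k+1}$ and $s_kRt$ for all $k$, then there is $t'$ with $t\xrightarrow{\tau}t'$ and $s_kRt'$ for some $k$; (D2) if $sRt$ and there is an infinite sequence $(t_n)_{n\in\mathbb N}$ with $t_0=t$, $t_k\xrightarrow{\tau}t_{k+1}$ and $sRt_k$ for all $k$, then there is $s'$ with $s\xrightarrow{\tau}s'$ and $s'Rt_k$ for some $k$. Two LPEs with initial states $d_0,d_0'$ are divergence-preserving branching bisimilar iff some such $R$ satisfies $d_0Rd_0'$. -}

module Defs where

open import Data.Bool using (Bool; true; false; T; not)
open import Data.Maybe using (Maybe; just; nothing)
open import Data.Nat using (ℕ; suc)
open import Data.Product using (Σ; ∃; ∃-syntax; _×_; _,_)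
open import Data.Sum using (_⊎_)
open import Relation.Binary.PropositionalEquality using (_≡_; _≢_)
open import Relation.Binary.Construct.Closure.ReflexiveTransitive using (Star)

data Lab (Act : Set) : Set where
  act : Act → Lab Act
  int : Lab Act

data Cone : Set where
  Δ ∇ : Cone

record LPE (Act : Set) (E F : Lab Act → Set) (D : Set) : Set where
  field
    c : (a : Lab Act) → D → E a → Bool
    f : (a : Lab Act) → D → E a → F a
    g : (a : Lab Act) → D → E a → D

-- Observable transition labels: nothing = τ (silent), just (a , v) = a(v).
Obs : (Act : Set) (F : Lab Act → Set) → Set
Obs Act F = Maybe (Σ Act λ a → F (act a))

-- Transitions of an LPE.  `tau = just t` says that t ∈ Act is the action τ;
-- `tau = nothing` says τ ∉ Act.  Transitions labelled int or τ are silent.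
module _ {Act : Set} {E F : Lab Act → Set} {D : Set}
         (tau : Maybe Act) (L : LPE Act E F D) where
  open LPE L

  data Step : D → Obs Act F → D → Set where
    intStep : ∀ {d} (e : E int) → T (c int d e) → Step d nothing (g int d e)
    tauStep : ∀ {d} (a : Act) → tau ≡ just a → (e : E (act a)) →
              T (c (act a) d e) → Step d nothing (g (act a) d e)
    visStep : ∀ {d} (a : Act) → tau ≢ just a → (e : E (act a)) →
              T (c (act a) d e) →
              Step d (just (a , f (act a) d e)) (g (act a) d e)

  IntStep : D → D → Set
  IntStep d d' = Σ (E int) λ e → T (c int d e) × g int d e ≡ d'

  IntSteps : D → D → Set
  IntSteps = Star IntStep

-- Divergence-preserving branching bisimulation between two LTSs with the
-- same label set Obs (nothing = τ).
module _ {L S S' : Set}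
         (step  : S  → Maybe L → S  → Set)
         (step' : S' → Maybe L → S' → Set) where

  τ* : S → S → Set
  τ* = Star (λ x y → step x nothing y)

  τ*' : S' → S' → Set
  τ*' = Star (λ x y → step' x nothing y)

  record IsDPBB (R : S → S' → Set) : Set where
    field
      B1 : ∀ {s t s' l} → R s t → step s l s' →
             (l ≡ nothing × R s' t) ⊎
             (∃[ t₁ ] ∃[ t₂ ] (τ*' t t₁ × step' t₁ l t₂ × R s t₁ × R s' t₂))
      B2 : ∀ {s t t' l} → R s t → step' t l t' →
             (l ≡ nothing × R s t') ⊎
             (∃[ s₁ ] ∃[ s₂ ] (τ* s s₁ × step s₁ l s₂ × R s₁ t × R s₂ t'))
      D1 : ∀ {s t} → R s t → (σ : ℕ → S) → σ 0 ≡ s →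
             (∀ k → step (σ k) nothing (σ (suc k))) → (∀ k → R (σ k) t) →
             ∃[ t₁ ] (step' t nothing t₁ × ∃[ k ] R (σ k) t₁)
      D2 : ∀ {s t} → R s t → (σ : ℕ → S') → σ 0 ≡ t →
             (∀ k → step' (σ k) nothing (σ (suc k))) → (∀ k → R s (σ k)) →
             ∃[ s₁ ] (step s nothing s₁ × ∃[ k ] R s₁ (σ k))

  DPBBisimilar : S → S' → Set₁
  DPBBisimilar s₀ t₀ = Σ (S → S' → Set) λ R → IsDPBB R × R s₀ t₀

-- The relation  s R t  ⇔  I(s) ∧ h(s) = t  is a divergence-preserving branching
-- bisimulation.  Internal steps of X preserve R by (II), and action steps of X are
-- matched in Y by (IV)–(VI).  Conversely, an action of Y at h(s) is matched by
-- first following the well-founded ordering <M through internal steps to a focus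
-- point (I), and then to a state enabling the action (III).  For divergence: a
-- Δ-state of Y has an internal self-loop (IΔ, IIΔ), while at a ∇-state every
-- internal step of X decreases <M (IVΔ), so an infinite silent run of X related to
-- a ∇-state must contain a τ-step, which Y mirrors as a τ-self-loop.  Dually, a
-- silent step of Y that stays related to s is answered by a silent step of X,
-- using (I) outside the focus and (IIIΔ) or (III) at a focus point.
module Submission where

open import Defs
open import Data.Bool using (Bool; true; false; T; not)
open import Data.Maybe using (Maybe; just; nothing)
open import Data.Nat using (ℕ; suc)
open import Data.Product using (∃; ∃-syntax; _×_; _,_; proj₁; proj₂)
open import Data.Sum using (_⊎_; inj₁; inj₂)
open import Data.Unit using (tt)
open import Function.Base using (_∘_)
open import Function.Bundles using (_⇔_; Equivalence)
open import Induction.WellFounded using (WellFounded; Acc; acc)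
open import Relation.Binary.PropositionalEquality using (_≡_; refl; sym; trans; subst)
open import Relation.Binary.Construct.Closure.ReflexiveTransitive using (ε; _◅_; _◅◅_)
import Relation.Binary.Construct.Closure.ReflexiveTransitive as Star

escapeDescent : ∀ {A P : Set} {_<_ : A → A → Set} → WellFounded _<_ →
                (σ : ℕ → A) → (∀ k → σ (suc k) < σ k ⊎ P) → P
escapeDescent {P = P} {_<_} wf σ next = go 0 (wf (σ 0))
  where
  go : ∀ k → Acc _<_ (σ k) → P
  go k (acc rs) with next k
  ... | inj₁ σ₁<σ₀ = go (suc k) (rs σ₁<σ₀)
  ... | inj₂ p     = p

module _ {Act : Set} (tau : Maybe Act) {E F : Lab Act → Set} {D : Set}
         (L : LPE Act E F D) where

  intStep⇒silentStep : ∀ {d d'} → IntStep tau L d d' → Step tau L d nothing d'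
  intStep⇒silentStep (e , enabled , refl) = intStep e enabled

  intSteps⇒τ* : ∀ {d d'} → IntSteps tau L d d' → τ* (Step tau L) (Step tau L) d d'
  intSteps⇒τ* = Star.map intStep⇒silentStep

module ConesAndFoci {Act : Set} (tau : Maybe Act) {E F : Lab Act → Set} {D D' : Set}
    (X : LPE Act E F D) (Y : LPE Act E F D') (I : D → Set)
    (inv : ∀ a d e → I d → T (LPE.c X a d e) → I (LPE.g X a d e))
    (h : D → D') (FC : D → Bool) (_<M_ : D → D → Set) (wf : WellFounded _<M_)
    (p : D' → Cone)
    (reqI : ∀ d → I d → T (not (FC d)) →
              ∃[ e ] (T (LPE.c X int d e) × LPE.g X int d e <M d))
    (reqII : ∀ d → I d → ∀ e → T (LPE.c X int d e) → h d ≡ h (LPE.g X int d e))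
    (reqIII : ∀ d → I d → ∀ a e → T (FC d) → T (LPE.c Y (act a) (h d) e) →
                ∃[ dint ] (IntSteps tau X d dint × T (LPE.c X (act a) dint e)))
    (reqIV : ∀ d → I d → ∀ a e → T (LPE.c X (act a) d e) → T (LPE.c Y (act a) (h d) e))
    (reqV : ∀ d → I d → ∀ a e → T (LPE.c X (act a) d e) →
              LPE.f X (act a) d e ≡ LPE.f Y (act a) (h d) e)
    (reqVI : ∀ d → I d → ∀ a e → T (LPE.c X (act a) d e) →
               h (LPE.g X (act a) d e) ≡ LPE.g Y (act a) (h d) e)
    (reqIΔ : ∀ d → I d → ∀ e → T (LPE.c Y int (h d) e) → LPE.g Y int (h d) e ≡ h d)
    (reqIIΔ : ∀ d → I d → (p (h d) ≡ Δ ⇔ (∃[ e ] T (LPE.c Y int (h d) e))))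
    (reqIIIΔ : ∀ d → I d → T (FC d) → (p (h d) ≡ Δ ⇔ (∃[ e ] T (LPE.c X int d e))))
    (reqIVΔ : ∀ d → I d → ∀ e → p (h d) ≡ ∇ → T (LPE.c X int d e) → LPE.g X int d e <M d)
    where
  open LPE
  open Equivalence using (to; from)

  R : D → D' → Set
  R s t = I s × h s ≡ t

  R-functional : ∀ {s t t'} → R s t → R s t' → t ≡ t'
  R-functional (_ , hs≡t) (_ , hs≡t') = trans (sym hs≡t) hs≡t'

  intStep-preserves-R : ∀ {s s' t} → R s t → IntStep tau X s s' → R s' t
  intStep-preserves-R (i , refl) (e , enabled , refl) =
    inv int _ e i enabled , sym (reqII _ i e enabled)

  intSteps-preserve-R : ∀ {s s' t} → R s t → IntSteps tau X s s' → R s' t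
  intSteps-preserve-R r ε          = r
  intSteps-preserve-R r (st ◅ sts) = intSteps-preserve-R (intStep-preserves-R r st) sts

  action-transfer : ∀ {s t a e} → R s t → T (c X (act a) s e) →
    T (c Y (act a) t e) × f X (act a) s e ≡ f Y (act a) t e ×
    R (g X (act a) s e) (g Y (act a) t e)
  action-transfer (i , refl) enabled =
    reqIV _ i _ _ enabled , reqV _ i _ _ enabled , inv _ _ _ i enabled , reqVI _ i _ _ enabled

  reach-focus : ∀ {s} → I s → Acc _<M_ s → ∃[ s' ] (IntSteps tau X s s' × T (FC s'))
  reach-focus {s} i (acc rs) with FC s in focus | reqI s i
  ... | true  | _    = s , ε , subst T (sym focus) tt
  ... | false | exit with exit tt
  ...   | e , enabled , s₁<s with reach-focus (inv int s e i enabled) (rs s₁<s)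
  ...     | s' , sts , focused = s' , (e , enabled , refl) ◅ sts , focused

  focused-action : ∀ {s t a e} → R s t → T (FC s) → T (c Y (act a) t e) →
    ∃[ s₁ ] (IntSteps tau X s s₁ × T (c X (act a) s₁ e))
  focused-action (i , refl) = reqIII _ i _ _

  match-action : ∀ {s t a e} → R s t → T (c Y (act a) t e) →
    ∃[ s₁ ] (IntSteps tau X s s₁ × R s₁ t × T (c X (act a) s₁ e))
  match-action {s} r@(i , _) enabled' with reach-focus i (wf s)
  ... | s₁ , sts₁ , focused with focused-action (intSteps-preserve-R r sts₁) focused enabled'
  ...   | s₂ , sts₂ , enabled =
    s₂ , sts₁ ◅◅ sts₂ , intSteps-preserve-R r (sts₁ ◅◅ sts₂) , enabled

  Δ-selfLoop : ∀ {s t} → R s t → p t ≡ Δ → Step tau Y t nothing t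
  Δ-selfLoop {s} (i , refl) pt≡Δ with to (reqIIΔ s i) pt≡Δ
  ... | e , enabled = subst (Step tau Y (h s) nothing) (reqIΔ s i e enabled) (intStep e enabled)

  ∇-descend-or-selfLoop : ∀ {s s' t} → R s t → R s' t → p t ≡ ∇ →
    Step tau X s nothing s' → s' <M s ⊎ Step tau Y t nothing t
  ∇-descend-or-selfLoop (i , refl) _ pt≡∇ (intStep e enabled) =
    inj₁ (reqIVΔ _ i e pt≡∇ enabled)
  ∇-descend-or-selfLoop r r' _ (tauStep a tau≡a e enabled) with action-transfer r enabled
  ... | enabled' , _ , r'' =
    inj₂ (subst (Step tau Y _ nothing) (R-functional r'' r') (tauStep a tau≡a e enabled'))

  divergence-selfLoop : ∀ {t} (σ : ℕ → D) → (∀ k → Step tau X (σ k) nothing (σ (suc k))) →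
    (∀ k → R (σ k) t) → Step tau Y t nothing t
  divergence-selfLoop {t} σ steps related with p t in pt
  ... | Δ = Δ-selfLoop (related 0) pt
  ... | ∇ = escapeDescent wf σ
              (λ k → ∇-descend-or-selfLoop (related k) (related (suc k)) pt (steps k))

  internal-answer : ∀ {s t e} → R s t → T (c X int s e) →
    ∃[ s₁ ] (Step tau X s nothing s₁ × R s₁ t)
  internal-answer {e = e} r enabled =
    _ , intStep e enabled , intStep-preserves-R r (e , enabled , refl)

  silent-answer : ∀ {s t t'} → R s t → Step tau Y t nothing t' → R s t' →
    ∃[ s₁ ] (Step tau X s nothing s₁ × R s₁ t)
  silent-answer {s} r@(i , refl) st' r' with FC s | reqI s i | reqIIIΔ s i | reqIII s i | st'
  ... | false | exit | _ | _ | _ with exit tt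
  ...   | _ , enabled , _ = internal-answer r enabled
  silent-answer r@(i , refl) _ _ | true | _ | focusΔ | _ | intStep e enabled' =
    internal-answer r (proj₂ (to (focusΔ tt) (from (reqIIΔ _ i) (e , enabled'))))
  silent-answer r _ r' | true | _ | _ | focusAct | tauStep a tau≡a e enabled'
    with focusAct a e tt enabled'
  ... | _ , ε , enabled with action-transfer r enabled
  ...   | _ , _ , r'' = _ , tauStep a tau≡a e enabled , subst (R _) (R-functional r' r) r''
  silent-answer r _ _ | true | _ | _ | _ | tauStep _ _ _ _ | _ , (_ , enabled₁ , refl) ◅ _ , _ =
    internal-answer r enabled₁

  R-isDPBB : IsDPBB (Step tau X) (Step tau Y) R
  R-isDPBB = record { B1 = B1 ; B2 = B2 ; D1 = D1 ; D2 = D2 }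
    where
    B1 : ∀ {s t s' l} → R s t → Step tau X s l s' →
           (l ≡ nothing × R s' t) ⊎
           (∃[ t₁ ] ∃[ t₂ ] (τ*' (Step tau X) (Step tau Y) t t₁ ×
                              Step tau Y t₁ l t₂ × R s t₁ × R s' t₂))
    B1 r (intStep e enabled) = inj₁ (refl , intStep-preserves-R r (e , enabled , refl))
    B1 r (tauStep a tau≡a e enabled) with action-transfer r enabled
    ... | enabled' , _ , r' = inj₂ (_ , _ , ε , tauStep a tau≡a e enabled' , r , r')
    B1 r (visStep a tau≢a e enabled) with action-transfer r enabled
    ... | enabled' , f≡f' , r' =
      inj₂ (_ , _ , ε , subst (λ v → Step tau Y _ (just (a , v)) _) (sym f≡f')
                              (visStep a tau≢a e enabled') , r , r')

    B2 : ∀ {s t t' l} → R s t → Step tau Y t l t' →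
           (l ≡ nothing × R s t') ⊎
           (∃[ s₁ ] ∃[ s₂ ] (τ* (Step tau X) (Step tau Y) s s₁ ×
                              Step tau X s₁ l s₂ × R s₁ t × R s₂ t'))
    B2 (i , refl) (intStep e enabled') = inj₁ (refl , i , sym (reqIΔ _ i e enabled'))
    B2 r (tauStep a tau≡a e enabled') with match-action r enabled'
    ... | s₁ , sts , r₁ , enabled with action-transfer r₁ enabled
    ...   | _ , _ , r' = inj₂ (s₁ , _ , intSteps⇒τ* tau X sts , tauStep a tau≡a e enabled , r₁ , r')
    B2 r (visStep a tau≢a e enabled') with match-action r enabled'
    ... | s₁ , sts , r₁ , enabled with action-transfer r₁ enabled
    ...   | _ , f≡f' , r' =
      inj₂ (s₁ , _ , intSteps⇒τ* tau X sts ,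
            subst (λ v → Step tau X s₁ (just (a , v)) _) f≡f' (visStep a tau≢a e enabled) ,
            r₁ , r')

    D1 : ∀ {s t} → R s t → (σ : ℕ → D) → σ 0 ≡ s →
           (∀ k → Step tau X (σ k) nothing (σ (suc k))) → (∀ k → R (σ k) t) →
           ∃[ t₁ ] (Step tau Y t nothing t₁ × ∃[ k ] R (σ k) t₁)
    D1 {t = t} _ σ _ steps related = t , divergence-selfLoop σ steps related , 0 , related 0

    D2 : ∀ {s t} → R s t → (σ : ℕ → D') → σ 0 ≡ t →
           (∀ k → Step tau Y (σ k) nothing (σ (suc k))) → (∀ k → R s (σ k)) →
           ∃[ s₁ ] (Step tau X s nothing s₁ × ∃[ k ] R s₁ (σ k))
    D2 r σ refl steps related with silent-answer r (steps 0) (related 1)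
    ... | s₁ , st , r₁ = s₁ , st , 0 , r₁

theorem1 : (Act : Set) (tau : Maybe Act) (E F : Lab Act → Set)
    (D D' : Set) (X : LPE Act E F D) (Y : LPE Act E F D') (d₀ : D) (d₀' : D')
    (I : D → Set)
    → (∀ a d e → I d → T (LPE.c X a d e) → I (LPE.g X a d e))
    → I d₀
    → (h : D → D') (FC : D → Bool) (_<M_ : D → D → Set) → WellFounded _<M_
    → (p : D' → Cone)
    → h d₀ ≡ d₀'
    → (∀ d → I d →
         -- (I)
         (T (not (FC d)) →
            ∃[ e ] (T (LPE.c X int d e) × LPE.g X int d e <M d))
         -- (II)
       × (∀ e → T (LPE.c X int d e) → h d ≡ h (LPE.g X int d e))
         -- (III)
       × (∀ a e → T (FC d) → T (LPE.c Y (act a) (h d) e) →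
            ∃[ dint ] (IntSteps tau X d dint × T (LPE.c X (act a) dint e)))
         -- (IV)
       × (∀ a e → T (LPE.c X (act a) d e) → T (LPE.c Y (act a) (h d) e))
         -- (V)
       × (∀ a e → T (LPE.c X (act a) d e) →
            LPE.f X (act a) d e ≡ LPE.f Y (act a) (h d) e)
         -- (VI)
       × (∀ a e → T (LPE.c X (act a) d e) →
            h (LPE.g X (act a) d e) ≡ LPE.g Y (act a) (h d) e)
         -- (I Δ)
       × (∀ e → T (LPE.c Y int (h d) e) → LPE.g Y int (h d) e ≡ h d)
         -- (II Δ)
       × (p (h d) ≡ Δ ⇔ (∃[ e ] T (LPE.c Y int (h d) e)))
         -- (III Δ)
       × (T (FC d) → (p (h d) ≡ Δ ⇔ (∃[ e ] T (LPE.c X int d e))))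
         -- (IV Δ)
       × (∀ e → p (h d) ≡ ∇ → T (LPE.c X int d e) → LPE.g X int d e <M d))
    → DPBBisimilar (Step tau X) (Step tau Y) d₀ d₀'
theorem1 Act tau E F D D' X Y d₀ d₀' I inv Id₀ h FC _<M_ wf p hd₀≡d₀' reqs =
  R , R-isDPBB , Id₀ , hd₀≡d₀'
  where
  open ConesAndFoci tau X Y I inv h FC _<M_ wf p
    (λ d i → proj₁ (reqs d i))
    (λ d i → (proj₁ ∘ proj₂) (reqs d i))
    (λ d i → (proj₁ ∘ proj₂ ∘ proj₂) (reqs d i))
    (λ d i → (proj₁ ∘ proj₂ ∘ proj₂ ∘ proj₂) (reqs d i))
    (λ d i → (proj₁ ∘ proj₂ ∘ proj₂ ∘ proj₂ ∘ proj₂) (reqs d i))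
    (λ d i → (proj₁ ∘ proj₂ ∘ proj₂ ∘ proj₂ ∘ proj₂ ∘ proj₂) (reqs d i))
    (λ d i → (proj₁ ∘ proj₂ ∘ proj₂ ∘ proj₂ ∘ proj₂ ∘ proj₂ ∘ proj₂) (reqs d i))
    (λ d i → (proj₁ ∘ proj₂ ∘ proj₂ ∘ proj₂ ∘ proj₂ ∘ proj₂ ∘ proj₂ ∘ proj₂) (reqs d i))
    (λ d i → (proj₁ ∘ proj₂ ∘ proj₂ ∘ proj₂ ∘ proj₂ ∘ proj₂ ∘ proj₂ ∘ proj₂ ∘ proj₂) (reqs d i))
    (λ d i → (proj₂ ∘ proj₂ ∘ proj₂ ∘ proj₂ ∘ proj₂ ∘ proj₂ ∘ proj₂ ∘ proj₂ ∘ proj₂) (reqs d i))
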